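{- Let $D$ be a signed digraph on $[n]$ and $s\ge2$. If $D$ has no non-negative cycle, then the guessing graph $\mathrm{G}(D,s)$ is a complete graph.
   Context: A signed digraph on $[n]=\{0,\dots,n-1\}$ is $D=([n],E,\lambda)$ with $E\subseteq[n]\times[n]$ (loops allowed) and $\lambda:E\to\{ -1,0,1\}$. For $i\in[n]$, $N^\alpha(i)=\{j:(j,i)\in E,\lambda(j,i)=\alpha\}$ and $N(i)$ is the union of these. $[s]=\{0,\dots,s-1\}$. $F(D,s)$ is the set of maps $f:[s]^n\to[s]^n$ such that each $f_i$ depends only on $x_{N(i)}$, is non-decreasing in $x_j$ when $\lambda(j,i)=1$ and non-increasing in $x_j$ when $\lambda(j,i)=-1$. The guessing graph $\mathrm{G}(D,s)$ is the simple graph on $[s]^n$ where distinct $x,y$ are adjacent iff no $f\in F(D,s)$ has both $x$ and $y$ as fixed points. A cycle of $D$ is a directed cycle (a loop counts as a cycle of length 1); its sign is the product of the signs $\lambda$ of its arcs, and it is non-negative if this product is $\ge 0$. -}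

module Defs where

open import Data.Nat using (ℕ; _≤_)
open import Data.Fin as Fin using (Fin)
open import Data.Vec using (Vec; lookup)
open import Data.Maybe using (Maybe; just; nothing)
open import Data.List using (List; []; _∷_)
open import Data.List.Relation.Unary.Unique.Propositional using (Unique)
open import Data.Product using (Σ; ∃; _×_; _,_)
open import Relation.Binary.PropositionalEquality using (_≡_; _≢_)
open import Relation.Nullary using (¬_)

data Sign : Set where
  minus zer plus : Sign

_·_ : Sign → Sign → Sign
zer   · _     = zer
_     · zer   = zer
plus  · b     = b
minus · plus  = minus
minus · minus = plus

-- A signed digraph on [n]: arc j i ≡ just σ  iff  (j,i) ∈ E and λ(j,i) = σ.
-- Loops allowed (arc i i may be defined).
record SignedDigraph (n : ℕ) : Set where
  field
    arc : Fin n → Fin n → Maybe Sign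
open SignedDigraph public

InN : ∀ {n} → SignedDigraph n → Fin n → Fin n → Set
InN D j i = ∃ λ σ → arc D j i ≡ just σ

Config : ℕ → ℕ → Set
Config n s = Vec (Fin s) n

record InF {n s : ℕ} (D : SignedDigraph n) (f : Config n s → Config n s) : Set where
  field
    local : ∀ i (x y : Config n s) →
      (∀ j → InN D j i → lookup x j ≡ lookup y j) →
      lookup (f x) i ≡ lookup (f y) i
    mono+ : ∀ i j → arc D j i ≡ just plus → (x y : Config n s) →
      (∀ k → k ≢ j → lookup x k ≡ lookup y k) →
      lookup x j Fin.≤ lookup y j → lookup (f x) i Fin.≤ lookup (f y) i
    mono- : ∀ i j → arc D j i ≡ just minus → (x y : Config n s) →
      (∀ k → k ≢ j → lookup x k ≡ lookup y k) →
      lookup x j Fin.≤ lookup y j → lookup (f y) i Fin.≤ lookup (f x) i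

GAdj : ∀ {n} → SignedDigraph n → (s : ℕ) → Config n s → Config n s → Set
GAdj {n} D s x y =
  x ≢ y × ¬ (Σ (Config n s → Config n s) λ f → InF D f × f x ≡ x × f y ≡ y)

GComplete : ∀ {n} → SignedDigraph n → ℕ → Set
GComplete {n} D s = (x y : Config n s) → x ≢ y → GAdj D s x y

-- Arcs of the closed walk v0 → v1 → … → v_{k-1} → v0, given start v0
closeArcs : ∀ {n} → Fin n → Fin n → List (Fin n) → List (Fin n × Fin n)
closeArcs v0 u []       = (u , v0) ∷ []
closeArcs v0 u (w ∷ ws) = (u , w) ∷ closeArcs v0 w ws

cycleArcs : ∀ {n} → Fin n → List (Fin n) → List (Fin n × Fin n)
cycleArcs v vs = closeArcs v v vs

walkSign : ∀ {n} → SignedDigraph n → List (Fin n × Fin n) → Maybe Sign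
walkSign D [] = just plus
walkSign D ((j , i) ∷ as) with arc D j i | walkSign D as
... | just σ | just τ = just (σ · τ)
... | _      | _      = nothing

-- A directed cycle (distinct vertices v ∷ vs, length ≥ 1, loops allowed)
-- with non-negative sign (product ∈ {0,1}, i.e. not -1)
NonNegCycle : ∀ {n} → SignedDigraph n → Set
NonNegCycle {n} D =
  Σ (Fin n) λ v → Σ (List (Fin n)) λ vs →
    Unique (v ∷ vs) × (Σ Sign λ σ → walkSign D (cycleArcs v vs) ≡ just σ × σ ≢ minus)

module Submission where

-- Suppose f fixes x ≠ y and orient every coordinate j by τ(j) = + if
-- x_j < y_j and τ(j) = − otherwise.  Walking from x to y one coordinate at
-- a time, f_i can only increase at a step that crosses an arc j → i able to
-- raise f_i; since f_i(x) = x_i < y_i = f_i(y) such an arc exists.  Hence every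
-- coordinate i with x_i ≠ y_i has a predecessor j with x_j ≠ y_j along an
-- arc of sign σ that is "consistent": σ = 0 or σ·τ(j) = τ(i).  Following
-- predecessors inside the finite set of differing coordinates closes a
-- directed cycle of consistent arcs, and the product of the signs of such a
-- cycle carries τ(v) to τ(v) ≠ 0, so it is 0 or +: a non-negative cycle.

open import Defs
open import Data.Nat as ℕ using (ℕ; _≤_; _+_)
import Data.Nat.Properties as ℕP
open import Data.Fin as Fin using (Fin; zero; suc)
import Data.Fin.Properties as FinP
open import Data.Vec using (Vec; []; _∷_; lookup)
open import Data.Vec.Relation.Binary.Pointwise.Extensional using (ext; Pointwise-≡⇒≡)
open import Data.Maybe using (just; nothing)
open import Data.List as List using (List; []; _∷_; length)
open import Data.List.Relation.Unary.Unique.Propositional using (Unique)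
open import Data.List.Relation.Unary.AllPairs using ([]; _∷_)
open import Data.List.Relation.Unary.All as All using ([])
open import Data.List.Relation.Unary.All.Properties using (anti-mono; ¬Any⇒All¬)
open import Data.List.Relation.Unary.Any using (here; there)
open import Data.List.Membership.Propositional using (_∈_)
open import Data.List.Membership.Propositional.Properties using (∈-lookup)
open import Data.List.Relation.Binary.Subset.Propositional using (_⊆_)
open import Data.List.Relation.Binary.Subset.Propositional.Properties using (∷⁺ʳ)
open import Data.Product using (Σ; ∃; ∃₂; _×_; _,_)
open import Data.Sum using (_⊎_; inj₁; inj₂)
open import Function using (_∘_)
open import Relation.Binary using (Rel; DecidableEquality; Reflexive; Transitive; tri<; tri≈; tri>)
open import Relation.Binary.PropositionalEquality
open import Relation.Nullary using (¬_; Dec; yes; no; contradiction)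
open import Relation.Nullary.Decidable using (¬?; map′; decidable-stable)

·-comm : ∀ a b → a · b ≡ b · a
·-comm zer   zer   = refl
·-comm zer   plus  = refl
·-comm zer   minus = refl
·-comm plus  zer   = refl
·-comm plus  plus  = refl
·-comm plus  minus = refl
·-comm minus zer   = refl
·-comm minus plus  = refl
·-comm minus minus = refl

·-assoc : ∀ a b c → (a · b) · c ≡ a · (b · c)
·-assoc zer   b     c     = refl
·-assoc plus  zer   c     = refl
·-assoc minus zer   c     = refl
·-assoc plus  plus  zer   = refl
·-assoc plus  plus  plus  = refl
·-assoc plus  plus  minus = refl
·-assoc plus  minus zer   = refl
·-assoc plus  minus plus  = refl
·-assoc plus  minus minus = refl
·-assoc minus plus  zer   = refl
·-assoc minus plus  plus  = refl
·-assoc minus plus  minus = refl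
·-assoc minus minus zer   = refl
·-assoc minus minus plus  = refl
·-assoc minus minus minus = refl

-- An arc of sign σ carries the orientation a of its tail to the orientation
-- b of its head when it is neutral or multiplying by σ turns a into b.
Carries : Sign → Sign → Sign → Set
Carries σ a b = σ ≡ zer ⊎ σ · a ≡ b

carries-plus : ∀ a → Carries plus a a
carries-plus zer   = inj₂ refl
carries-plus plus  = inj₂ refl
carries-plus minus = inj₂ refl

carries-∘ : ∀ {σ π a b c} → Carries σ a b → Carries π b c → Carries (σ · π) a c
carries-∘             (inj₁ refl) _           = inj₁ refl
carries-∘ {σ}         (inj₂ _)    (inj₁ refl) = inj₁ (·-comm σ zer)
carries-∘ {σ} {π} {a} {b} {c} (inj₂ σa≡b) (inj₂ πb≡c) = inj₂ (begin
  (σ · π) · a  ≡⟨ cong (_· a) (·-comm σ π) ⟩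
  (π · σ) · a  ≡⟨ ·-assoc π σ a ⟩
  π · (σ · a)  ≡⟨ cong (π ·_) σa≡b ⟩
  π · b        ≡⟨ πb≡c ⟩
  c            ∎)
  where open ≡-Reasoning

carries-loop : ∀ {σ} a → Carries σ a a → a ≢ zer → σ ≢ minus
carries-loop zer   _        a≢0 _    = a≢0 refl
carries-loop plus  (inj₁ ()) _  refl
carries-loop plus  (inj₂ ()) _  refl
carries-loop minus (inj₁ ()) _  refl
carries-loop minus (inj₂ ()) _  refl

data Path {A : Set} (G : A → A → Set) : A → List A → Set where
  []  : ∀ {u} → Path G u []
  _∷_ : ∀ {u w ws} → G u w → Path G w ws → Path G u (w ∷ ws)

lastVertex : {A : Set} → A → List A → A
lastVertex u []       = u
lastVertex u (w ∷ ws) = lastVertex w ws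

-- A cycle v → v₁ → … → vₖ → v through distinct vertices, every arc in G;
-- these are exactly the data required of a cycle by NonNegCycle.
Cycle : {A : Set} → (A → A → Set) → A → List A → Set
Cycle G v vs = Unique (v ∷ vs) × Path G v vs × G (lastVertex v vs) v

lookup-injective : {A : Set} {xs : List A} → Unique xs →
                   ∀ {i j} → List.lookup xs i ≡ List.lookup xs j → i ≡ j
lookup-injective (_   ∷ _) {zero}  {zero}  _ = refl
lookup-injective (x∉ ∷ _) {zero}  {suc j} e = contradiction e (All.lookup x∉ (∈-lookup j))
lookup-injective (x∉ ∷ _) {suc i} {zero}  e = contradiction (sym e) (All.lookup x∉ (∈-lookup i))
lookup-injective (_   ∷ u) {suc i} {suc j} e = cong suc (lookup-injective u e)

unique-length : ∀ {n} {xs : List (Fin n)} → Unique xs → length xs ≤ n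
unique-length u = FinP.injective⇒≤ (lookup-injective u)

module CycleSearch {n} (G : Fin n → Fin n → Set) (P : Fin n → Set)
                   (predecessor : ∀ {i} → P i → ∃ λ j → P j × G j i) where
  open import Data.List.Membership.DecPropositional (FinP._≟_ {n}) using (_∈?_)

  cut-at : ∀ {u p} us → Path G u us → Unique (u ∷ us) → p ∈ u ∷ us →
           ∃ λ ws → ws ⊆ us × Unique (u ∷ ws) × Path G u ws × lastVertex u ws ≡ p
  cut-at us _ _ (here refl) = [] , (λ ()) , [] ∷ [] , [] , refl
  cut-at (w ∷ ws) (g ∷ path) (u∉ ∷ uq) (there p∈) with cut-at ws path uq p∈
  ... | ws′ , ws′⊆ws , uq′ , path′ , last≡p =
    let w∷ws′⊆w∷ws = ∷⁺ʳ w ws′⊆ws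
    in w ∷ ws′ , w∷ws′⊆w∷ws , anti-mono w∷ws′⊆w∷ws u∉ ∷ uq′ , g ∷ path′ , last≡p

  -- Extend a duplicate-free path backwards by predecessors until one of them
  -- is already on it; the fuel k suffices because the path cannot exceed n.
  grow : ∀ k {u} us → P u → Path G u us → Unique (u ∷ us) →
         n ℕ.< length (u ∷ us) + k → ∃₂ (Cycle G)
  grow ℕ.zero us _ _ uq bound =
    contradiction (unique-length uq) (ℕP.<⇒≱ (subst (n ℕ.<_) (ℕP.+-identityʳ _) bound))
  grow (ℕ.suc k) {u} us Pu path uq bound with predecessor Pu
  ... | p , Pp , Gpu with p ∈? u ∷ us
  ...   | no p∉ = grow k (u ∷ us) Pp (Gpu ∷ path) (¬Any⇒All¬ _ p∉ ∷ uq)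
                    (subst (n ℕ.<_) (ℕP.+-suc (length (u ∷ us)) k) bound)
  ...   | yes p∈ with cut-at us path uq p∈
  ...     | ws , _ , uq′ , path′ , last≡p =
    u , ws , uq′ , path′ , subst (λ q → G q u) (sym last≡p) Gpu

  find-cycle : ∀ {i} → P i → ∃₂ (Cycle G)
  find-cycle Pi = grow n [] Pi [] ([] ∷ []) (ℕP.n<1+n n)

Consistent : ∀ {n} → SignedDigraph n → (Fin n → Sign) → Fin n → Fin n → Set
Consistent D τ j i = Σ Sign λ σ → arc D j i ≡ just σ × Carries σ (τ j) (τ i)

walkSign-∷ : ∀ {n} {D : SignedDigraph n} {j i σ π} {as} → arc D j i ≡ just σ →
             walkSign D as ≡ just π → walkSign D ((j , i) ∷ as) ≡ just (σ · π)
walkSign-∷ arc≡σ sign≡π rewrite arc≡σ | sign≡π = refl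

closed-walk-sign : ∀ {n} {D : SignedDigraph n} {τ : Fin n → Sign} {v u} ws →
  Path (Consistent D τ) u ws → Consistent D τ (lastVertex u ws) v →
  ∃ λ π → walkSign D (closeArcs v u ws) ≡ just π × Carries π (τ u) (τ v)
closed-walk-sign {D = D} {τ} {v} [] [] (σ , arc≡σ , carries) =
  σ · plus , walkSign-∷ {D = D} {as = []} arc≡σ refl , carries-∘ carries (carries-plus (τ v))
closed-walk-sign {D = D} {v = v} (w ∷ ws) ((σ , arc≡σ , carries) ∷ path) closing
  with closed-walk-sign ws path closing
... | π , sign≡π , carriesπ =
  σ · π , walkSign-∷ {D = D} {as = closeArcs v w ws} arc≡σ sign≡π , carries-∘ carries carriesπ

-- A cycle of arcs consistent with a nowhere-zero orientation is non-negative: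
-- its sign carries τ(v) back to τ(v) ≠ 0.
consistent-cycle-nonneg : ∀ {n} {D : SignedDigraph n} {τ : Fin n → Sign} →
  (∀ j → τ j ≢ zer) → ∀ {v vs} → Cycle (Consistent D τ) v vs → NonNegCycle D
consistent-cycle-nonneg {τ = τ} τ≢0 {v} {vs} (distinct , path , closing)
  with closed-walk-sign vs path closing
... | π , sign≡π , carries = v , vs , distinct , π , sign≡π , carries-loop (τ v) carries (τ≢0 v)

DiffersOnlyAt : ∀ {A : Set} {n} → Fin n → Vec A n → Vec A n → Set
DiffersOnlyAt j z w = ∀ k → k ≢ j → lookup z k ≡ lookup w k

descend-coordinatewise :
  ∀ {A B : Set} {ℓ} {_≼_ : Rel B ℓ} → Reflexive _≼_ → Transitive _≼_ →
  ∀ {n} (g : Vec A n → B) (x y : Vec A n) →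
  (∀ j z w → DiffersOnlyAt j z w → lookup z j ≡ lookup x j → lookup w j ≡ lookup y j → g w ≼ g z) →
  g y ≼ g x
descend-coordinatewise ≼-refl ≼-trans g [] [] step = ≼-refl
descend-coordinatewise {_≼_ = _≼_} ≼-refl ≼-trans g (a ∷ xs) (b ∷ ys) step =
  ≼-trans (descend-coordinatewise {_≼_ = _≼_} ≼-refl ≼-trans (g ∘ (b ∷_)) xs ys tail-step) head-step
  where
  head-step : g (b ∷ xs) ≼ g (a ∷ xs)
  head-step = step zero (a ∷ xs) (b ∷ xs) (λ { zero k≢0 → contradiction refl k≢0 ; (suc k) _ → refl })
                   refl refl

  tail-step : ∀ j z w → DiffersOnlyAt j z w → lookup z j ≡ lookup xs j → lookup w j ≡ lookup ys j →
              g (b ∷ w) ≼ g (b ∷ z)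
  tail-step j z w only-j = step (suc j) (b ∷ z) (b ∷ w)
    (λ { zero _ → refl ; (suc k) k≢j → only-j k (k≢j ∘ cong suc) })

-- Raises σ a b: moving an input of an arc of sign σ from a to b may raise the
-- value of its head (for sign 0, any change may).
Raises : ∀ {s} → Sign → Fin s → Fin s → Set
Raises zer   a b = a ≢ b
Raises plus  a b = a Fin.< b
Raises minus a b = b Fin.< a

raises? : ∀ {s} σ (a b : Fin s) → Dec (Raises σ a b)
raises? zer   a b = ¬? (a FinP.≟ b)
raises? plus  a b = a FinP.<? b
raises? minus a b = b FinP.<? a

raises⇒≢ : ∀ {s} σ {a b : Fin s} → Raises σ a b → a ≢ b
raises⇒≢ zer   a≢b = a≢b
raises⇒≢ plus  a<b = FinP.<⇒≢ a<b
raises⇒≢ minus b<a = FinP.<⇒≢ b<a ∘ sym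

RaisingArc : ∀ {n s} → SignedDigraph n → Fin n → Config n s → Config n s → Fin n → Set
RaisingArc D i x y j = Σ Sign λ σ → arc D j i ≡ just σ × Raises σ (lookup x j) (lookup y j)

raisingArc? : ∀ {n s} (D : SignedDigraph n) i (x y : Config n s) j → Dec (RaisingArc D i x y j)
raisingArc? D i x y j with arc D j i
... | nothing = no λ { (_ , () , _) }
... | just σ  = map′ (λ r → σ , refl , r) (λ { (_ , refl , r) → r }) (raises? σ (lookup x j) (lookup y j))

Differs : ∀ {A : Set} {n} → Vec A n → Vec A n → Fin n → Set
Differs x y j = lookup x j ≢ lookup y j

differing-coordinate : ∀ {A : Set} → DecidableEquality A → ∀ {n} {x y : Vec A n} →
                       x ≢ y → ∃ (Differs x y)
differing-coordinate _≟_ {n} {x} {y} x≢y =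
  FinP.¬∀⟶∃¬ n _ (λ i → lookup x i ≟ lookup y i) (x≢y ∘ Pointwise-≡⇒≡ ∘ ext)

orient : ∀ {s} → Fin s → Fin s → Sign
orient a b with a FinP.<? b
... | yes _ = plus
... | no  _ = minus

orient-< : ∀ {s} {a b : Fin s} → a Fin.< b → orient a b ≡ plus
orient-< {a = a} {b} a<b with a FinP.<? b
... | yes _   = refl
... | no  a≮b = contradiction a<b a≮b

orient-> : ∀ {s} {a b : Fin s} → b Fin.< a → orient a b ≡ minus
orient-> {a = a} {b} b<a with a FinP.<? b
... | yes a<b = contradiction a<b (ℕP.<-asym b<a)
... | no  _   = refl

orient≢zer : ∀ {s} (a b : Fin s) → orient a b ≢ zer
orient≢zer a b with a FinP.<? b
... | yes _ = λ ()
... | no  _ = λ ()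

orientation : ∀ {n s} → Config n s → Config n s → Fin n → Sign
orientation x y j = orient (lookup x j) (lookup y j)

raising-carries⁺ : ∀ {s} σ {a b c d : Fin s} → Raises σ a b → c Fin.< d →
                   Carries σ (orient a b) (orient c d)
raising-carries⁺ zer   _   _   = inj₁ refl
raising-carries⁺ plus  a<b c<d rewrite orient-< a<b | orient-< c<d = inj₂ refl
raising-carries⁺ minus b<a c<d rewrite orient-> b<a | orient-< c<d = inj₂ refl

raising-carries⁻ : ∀ {s} σ {a b c d : Fin s} → Raises σ b a → d Fin.< c →
                   Carries σ (orient a b) (orient c d)
raising-carries⁻ zer   _   _   = inj₁ refl
raising-carries⁻ plus  b<a d<c rewrite orient-> b<a | orient-> d<c = inj₂ refl
raising-carries⁻ minus a<b d<c rewrite orient-< a<b | orient-> d<c = inj₂ refl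

module Network {n s} {D : SignedDigraph n} {f : Config n s → Config n s} (F : InF D f) where
  open InF F

  -- A single-coordinate change at j that cannot raise coordinate i through
  -- the arc j → i does not raise f_i: by locality if j ∉ N(i), and by the
  -- monotonicity of f_i in x_j otherwise.
  step-descends : ∀ i j (z w : Config n s) → DiffersOnlyAt j z w → ¬ RaisingArc D i z w j →
                  lookup (f w) i Fin.≤ lookup (f z) i
  step-descends i j z w only-j ¬raising with arc D j i in arc≡
  ... | nothing = FinP.≤-reflexive (local i w z agree-on-inputs)
    where
    agree-on-inputs : ∀ k → InN D k i → lookup w k ≡ lookup z k
    agree-on-inputs k (_ , arc≡σ) =
      sym (only-j k λ { refl → contradiction (trans (sym arc≡σ) arc≡) λ () })
  ... | just zer = FinP.≤-reflexive (local i w z (λ k _ → agree k))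
    where
    zj≡wj : lookup z j ≡ lookup w j
    zj≡wj = decidable-stable (lookup z j FinP.≟ lookup w j) (λ zj≢wj → ¬raising (zer , refl , zj≢wj))
    agree : ∀ k → lookup w k ≡ lookup z k
    agree k with k FinP.≟ j
    ... | yes refl = sym zj≡wj
    ... | no k≢j   = sym (only-j k k≢j)
  ... | just plus  = mono+ i j arc≡ w z (λ k k≢j → sym (only-j k k≢j))
                       (ℕP.≮⇒≥ (λ zj<wj → ¬raising (plus , refl , zj<wj)))
  ... | just minus = mono- i j arc≡ z w only-j
                       (ℕP.≮⇒≥ (λ wj<zj → ¬raising (minus , refl , wj<zj)))

  -- If f fixes x and y and x_i < y_i, some arc j → i may raise coordinate i
  -- on the way from x to y; otherwise f_i(y) ≤ f_i(x) by the coordinatewise walk.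
  raising-arc : ∀ {x y} → f x ≡ x → f y ≡ y → ∀ i → lookup x i Fin.< lookup y i →
                ∃ (RaisingArc D i x y)
  raising-arc {x} {y} fx≡x fy≡y i xi<yi with FinP.any? (raisingArc? D i x y)
  ... | yes raising = raising
  ... | no ¬raising = contradiction yi≤xi (ℕP.<⇒≱ xi<yi)
    where
    fi : Config n s → Fin s
    fi v = lookup (f v) i

    fyi≤fxi : fi y Fin.≤ fi x
    fyi≤fxi = descend-coordinatewise {_≼_ = Fin._≤_} ℕP.≤-refl ℕP.≤-trans fi x y
      (λ j z w only-j zj≡xj wj≡yj → step-descends i j z w only-j
        (λ { (σ , arc≡σ , r) → ¬raising (j , σ , arc≡σ , subst₂ (Raises σ) zj≡xj wj≡yj r) }))

    yi≤xi : lookup y i Fin.≤ lookup x i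
    yi≤xi = subst₂ (λ u v → lookup u i Fin.≤ lookup v i) fy≡y fx≡x fyi≤fxi

  consistent-predecessor : ∀ {x y} → f x ≡ x → f y ≡ y → ∀ {i} → Differs x y i →
                           ∃ λ j → Differs x y j × Consistent D (orientation x y) j i
  consistent-predecessor {x} {y} fx≡x fy≡y {i} xi≢yi with FinP.<-cmp (lookup x i) (lookup y i)
  ... | tri≈ _ xi≡yi _ = contradiction xi≡yi xi≢yi
  ... | tri< xi<yi _ _ with raising-arc fx≡x fy≡y i xi<yi
  ...   | j , σ , arc≡σ , r = j , raises⇒≢ σ r , σ , arc≡σ , raising-carries⁺ σ r xi<yi
  consistent-predecessor {x} {y} fx≡x fy≡y {i} xi≢yi | tri> _ _ yi<xi
    with raising-arc fy≡y fx≡x i yi<xi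
  ...   | j , σ , arc≡σ , r = j , raises⇒≢ σ r ∘ sym , σ , arc≡σ , raising-carries⁻ σ r yi<xi

proposition2 : ∀ {n} (D : SignedDigraph n) (s : ℕ) → 2 ≤ s → ¬ NonNegCycle D → GComplete D s
proposition2 {n} D s _ no-nonneg-cycle x y x≢y = x≢y , no-common-fixed-points
  where
  no-common-fixed-points : ¬ (Σ (Config n s → Config n s) λ f → InF D f × f x ≡ x × f y ≡ y)
  no-common-fixed-points (f , F , fx≡x , fy≡y) =
    let open Network F
        open CycleSearch (Consistent D (orientation x y)) (Differs x y)
                         (consistent-predecessor fx≡x fy≡y)
        (i , xi≢yi) = differing-coordinate FinP._≟_ x≢y
        (v , vs , cycle) = find-cycle xi≢yi
    in no-nonneg-cycle (consistent-cycle-nonneg (λ j → orient≢zer (lookup x j) (lookup y j)) cycle)
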